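{- Let $n$ be a positive integer and $m$ an integer with $n+1\le m\le 2n$. Then for every orbit $\mathcal{O}$ of $\partial_K$ acting on $\mathcal{L}_m(C_n)$, we have $(m-1)\mid \#\mathcal{O}$.
   Context: The comb $C_n$ is the poset with elements $x_1,\dots,x_n,y_1,\dots,y_n$ whose cover relations are $x_i\lessdot x_{i+1}$ for $1\le i\le n-1$ and $x_i\lessdot y_i$ for $1\le i\le n$ (so $x_1$ is the minimum, the $x_i$ form the spine, and each $y_i$ is a maximal element). For a positive integer $m$, an $m$-packed labeling of a finite poset $P$ is a surjection $L:P\to\{1,\dots,m\}$ such that $x<_P y$ implies $L(x)<L(y)$; $\mathcal{L}_m(P)$ is the set of them. $K$-promotion $\partial_K:\mathcal{L}_m(P)\to\mathcal{L}_m(P)$: given $L$, erase the labels of all elements labeled $1$; then for $i=2,\dots,m$ in turn, for every cover relation $x\lessdot y$ with $x$ currently unlabeled and $y$ currently labeled $i$, give $x$ label $i$ and erase the label of $y$ (simultaneously for all such pairs); finally decrease every existing label by $1$ and label every unlabeled element $m$. This is a bijection of $\mathcal{L}_m(P)$, and orbits are those of the cyclic group it generates. -}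

module Defs where

open import Data.Nat using (ℕ; zero; suc; _∸_; _≤_; _<_; _≡ᵇ_)
open import Data.Fin using (Fin; toℕ)
open import Data.List using (List; map; _++_)
open import Data.Bool.ListAction using (any)
open import Data.List.Base using (allFin)
open import Data.Bool using (Bool; true; false; _∧_; if_then_else_; T)
open import Data.Maybe using (Maybe; just; nothing; maybe; is-nothing)
open import Data.Product using (Σ; _×_; ∃)
open import Relation.Nullary using (¬_)
open import Relation.Binary.PropositionalEquality using (_≡_)
open import Relation.Binary.Construct.Closure.Transitive using (TransClosure)

-- Elements of the comb C_n (0-based indices): x i is x_{i+1}, y i is y_{i+1}.
data Elem (n : ℕ) : Set where
  x : Fin n → Elem n
  y : Fin n → Elem n

allElems : (n : ℕ) → List (Elem n)
allElems n = map x (allFin n) ++ map y (allFin n)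

covers : {n : ℕ} → Elem n → Elem n → Bool
covers (x i) (x j) = toℕ j ≡ᵇ suc (toℕ i)
covers (x i) (y j) = toℕ i ≡ᵇ toℕ j
covers (y _) _     = false

_⋖_ : {n : ℕ} → Elem n → Elem n → Set
a ⋖ b = T (covers a b)

_<C_ : {n : ℕ} → Elem n → Elem n → Set
_<C_ = TransClosure _⋖_

Labeling : ℕ → Set
Labeling n = Elem n → ℕ

IsPackedLabeling : (n m : ℕ) → Labeling n → Set
IsPackedLabeling n m L =
  (∀ e → 1 ≤ L e × L e ≤ m)
  × (∀ k → 1 ≤ k → k ≤ m → ∃ λ e → L e ≡ k)
  × (∀ a b → a <C b → L a < L b)

-- Intermediate states of K-promotion: partial labelings (nothing = unlabeled).
State : ℕ → Set
State n = Elem n → Maybe ℕ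

isLabel : ℕ → Maybe ℕ → Bool
isLabel i (just l) = l ≡ᵇ i
isLabel i nothing  = false

erase1 : {n : ℕ} → Labeling n → State n
erase1 L e = if L e ≡ᵇ 1 then nothing else just (L e)

-- Step for label i: for every cover a ⋖ b with a unlabeled and b labeled i,
-- label a with i and erase b (simultaneously, based on the current state).
slide : {n : ℕ} → ℕ → State n → State n
slide {n} i s e with s e
... | nothing = if any (λ b → covers e b ∧ isLabel i (s b)) (allElems n)
                  then just i else nothing
... | just l  = if (l ≡ᵇ i) ∧ any (λ a → covers a e ∧ is-nothing (s a)) (allElems n)
                  then nothing else just l

slidesFrom : {n : ℕ} → ℕ → ℕ → State n → State n
slidesFrom i zero    s = s
slidesFrom i (suc k) s = slidesFrom (suc i) k (slide i s)

finish : {n : ℕ} → ℕ → State n → Labeling n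
finish m s e = maybe (λ l → l ∸ 1) m (s e)

promotionK : {n : ℕ} → ℕ → Labeling n → Labeling n
promotionK m L = finish m (slidesFrom 2 (m ∸ 1) (erase1 L))

iter : {A : Set} → (A → A) → ℕ → A → A
iter f zero    a = a
iter f (suc k) a = f (iter f k a)

_≗L_ : {n : ℕ} → Labeling n → Labeling n → Set
L ≗L L' = ∀ e → L e ≡ L' e

IsOrbitSize : (n m : ℕ) → Labeling n → ℕ → Set
IsOrbitSize n m L p =
  0 < p × (iter (promotionK m) p L ≗L L)
  × (∀ k → 0 < k → k < p → ¬ (iter (promotionK m) k L ≗L L))

-- K-promotion maps m-packed labelings to m-packed labelings. On the comb, x₁ is the
-- only element labelled 1 and every element labelled 2 covers x₁. So if y₁ carries
-- l > 2, the 2 above x₁ slides into x₁ and y₁ leaves with l − 1; if y₁ carries 2, it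
-- slides into the hole at x₁, stays empty and leaves with m. Thus the label of y₁
-- minus 2 drops by one modulo m − 1 at every step, and a labeling can only recur
-- after a multiple of m − 1 steps.
module Submission where

open import Defs
open import Data.Nat using (ℕ; zero; suc; _+_; _*_; _∸_; _≤_; _<_; _≡ᵇ_; z≤n; s≤s)
open import Data.Nat.Properties
open import Data.Nat.Divisibility using (_∣_; divides)
open import Data.Fin using (zero; suc; toℕ; inject₁)
open import Data.Fin.Properties using (toℕ-inject₁)
open import Data.Bool using (true; false; _∧_; T)
open import Data.Bool.Properties using (T-∧)
open import Data.Bool.ListAction using (any)
open import Data.List using (map; allFin)
open import Data.List.Relation.Unary.Any as Any using ()
open import Data.List.Relation.Unary.Any.Properties using (any⁺; any⁻; ++⁺ˡ; ++⁺ʳ; map⁺)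
open import Data.List.Membership.Propositional.Properties using (∈-allFin)
open import Data.Maybe using (Maybe; just; nothing; maybe; is-nothing)
open import Data.Maybe.Properties using (just-injective)
open import Data.Product using (_×_; ∃; _,_; proj₁; proj₂)
open import Data.Sum using (_⊎_; inj₁; inj₂)
open import Data.Empty using (⊥-elim)
open import Data.Unit using (tt)
open import Function using (_∘_; Equivalence)
open import Relation.Nullary using (¬_; yes; no)
open import Relation.Binary.PropositionalEquality
open import Relation.Binary.Construct.Closure.Transitive using ([_])

open import Algebra.Properties.CommutativeSemigroup +-commutativeSemigroup using (xy∙z≈xz∙y)

open Equivalence using (to; from)

nothing≢just : ∀ {l : ℕ} → nothing ≢ just l
nothing≢just ()

nothing-or-just : (v : Maybe ℕ) → v ≡ nothing ⊎ ∃ λ l → v ≡ just l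
nothing-or-just nothing  = inj₁ refl
nothing-or-just (just l) = inj₂ (l , refl)

isLabel⇒≡ : ∀ i (v : Maybe ℕ) → T (isLabel i v) → v ≡ just i
isLabel⇒≡ i (just l) t = cong just (≡ᵇ⇒≡ l i t)

is-nothing⇒≡ : ∀ (v : Maybe ℕ) → T (is-nothing v) → v ≡ nothing
is-nothing⇒≡ nothing _ = refl

module _ {n : ℕ} where

  any-allElems⁺ : ∀ p (e : Elem n) → T (p e) → T (any p (allElems n))
  any-allElems⁺ p (x i) pe =
    any⁺ p (++⁺ˡ (map⁺ (Any.map (λ eq → subst (T ∘ p ∘ x) eq pe) (∈-allFin i))))
  any-allElems⁺ p (y i) pe =
    any⁺ p (++⁺ʳ (map x (allFin n)) (map⁺ (Any.map (λ eq → subst (T ∘ p ∘ y) eq pe) (∈-allFin i))))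

  any-allElems⁻ : ∀ p → T (any p (allElems n)) → ∃ λ (e : Elem n) → T (p e)
  any-allElems⁻ p t = Any.satisfied (any⁻ p (allElems n) t)

  UnderLabel : ℕ → State n → Elem n → Set
  UnderLabel i s e = ∃ λ b → e ⋖ b × s b ≡ just i

  OverHole : State n → Elem n → Set
  OverHole s e = ∃ λ a → a ⋖ e × s a ≡ nothing

  data SlideView (i : ℕ) (s : State n) (e : Elem n) : Maybe ℕ → Set where
    fill   : s e ≡ nothing → UnderLabel i s e → SlideView i s e (just i)
    empty  : s e ≡ nothing → ¬ UnderLabel i s e → SlideView i s e nothing
    vacate : s e ≡ just i → OverHole s e → SlideView i s e nothing
    keep   : ∀ l → s e ≡ just l → (l ≡ i → ¬ OverHole s e) → SlideView i s e (just l)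

  slide-view : ∀ i s e → SlideView i s e (slide i s e)
  slide-view i s e with s e in se
  ... | nothing with any (λ b → covers e b ∧ isLabel i (s b)) (allElems n) in found
  ...   | true =
          let (b , t) = any-allElems⁻ _ (subst T (sym found) tt)
              (c , d) = to T-∧ t
          in fill se (b , c , isLabel⇒≡ i (s b) d)
  ...   | false = empty se λ (b , c , sb) →
          subst T found (any-allElems⁺ _ b (from T-∧ (c , subst (T ∘ isLabel i) (sym sb) (≡⇒≡ᵇ i i refl))))
  slide-view i s e | just l with l ≡ᵇ i in l≡ᵇi
  ... | false = keep l se (λ l≡i _ → subst T l≡ᵇi (≡⇒≡ᵇ l i l≡i))
  ... | true with any (λ a → covers a e ∧ is-nothing (s a)) (allElems n) in found
  ...   | true = vacate (trans se (cong just (≡ᵇ⇒≡ l i (subst T (sym l≡ᵇi) tt))))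
            (let (a , t) = any-allElems⁻ _ (subst T (sym found) tt)
                 (c , d) = to T-∧ t
             in a , c , is-nothing⇒≡ (s a) d)
  ...   | false = keep l se λ _ (a , c , sa) →
          subst T found (any-allElems⁺ _ a (from T-∧ (c , subst (T ∘ is-nothing) (sym sa) tt)))

  slide-fill : ∀ i s e → s e ≡ nothing → UnderLabel i s e → slide i s e ≡ just i
  slide-fill i s e se u with slide i s e | slide-view i s e
  ... | _ | fill _ _    = refl
  ... | _ | empty _ ¬u  = ⊥-elim (¬u u)
  ... | _ | vacate p _  = ⊥-elim (nothing≢just (trans (sym se) p))
  ... | _ | keep _ p _  = ⊥-elim (nothing≢just (trans (sym se) p))

  slide-stays-empty : ∀ i s e → s e ≡ nothing → ¬ UnderLabel i s e → slide i s e ≡ nothing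
  slide-stays-empty i s e se ¬u with slide i s e | slide-view i s e
  ... | _ | fill _ u    = ⊥-elim (¬u u)
  ... | _ | empty _ _   = refl
  ... | _ | vacate p _  = ⊥-elim (nothing≢just (trans (sym se) p))
  ... | _ | keep _ p _  = ⊥-elim (nothing≢just (trans (sym se) p))

  slide-vacate : ∀ i s e → s e ≡ just i → OverHole s e → slide i s e ≡ nothing
  slide-vacate i s e se d with slide i s e | slide-view i s e
  ... | _ | fill p _    = ⊥-elim (nothing≢just (trans (sym p) se))
  ... | _ | empty p _   = ⊥-elim (nothing≢just (trans (sym p) se))
  ... | _ | vacate _ _  = refl
  ... | _ | keep _ p ¬d = ⊥-elim (¬d (just-injective (trans (sym p) se)) d)

  slide-keep : ∀ i s e {l} → s e ≡ just l → (l ≡ i → ¬ OverHole s e) → slide i s e ≡ just l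
  slide-keep i s e se ¬d with slide i s e | slide-view i s e
  ... | _ | fill p _    = ⊥-elim (nothing≢just (trans (sym p) se))
  ... | _ | empty p _   = ⊥-elim (nothing≢just (trans (sym p) se))
  ... | _ | vacate p d  = ⊥-elim (¬d (just-injective (trans (sym se) p)) d)
  ... | _ | keep _ p _  = trans (sym p) se

  slide-just⁻ : ∀ i s e {l} → slide i s e ≡ just l →
    (s e ≡ nothing × UnderLabel i s e × l ≡ i) ⊎ (s e ≡ just l × (l ≡ i → ¬ OverHole s e))
  slide-just⁻ i s e q with slide i s e | slide-view i s e | q
  ... | _ | fill p u    | refl = inj₁ (p , u , refl)
  ... | _ | keep _ p ¬d | refl = inj₂ (p , ¬d)

  slide-nothing⁻ : ∀ i s e → slide i s e ≡ nothing →
    (s e ≡ nothing × ¬ UnderLabel i s e) ⊎ (s e ≡ just i × OverHole s e)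
  slide-nothing⁻ i s e q with slide i s e | slide-view i s e | q
  ... | _ | empty p ¬u | refl = inj₁ (p , ¬u)
  ... | _ | vacate p d | refl = inj₂ (p , d)

  slide-keeps-label : ∀ i s e {l} → s e ≡ just l → ∃ λ e′ → slide i s e′ ≡ just l
  slide-keeps-label i s e se with slide i s e | slide-view i s e
  ... | _ | fill p _  = ⊥-elim (nothing≢just (trans (sym p) se))
  ... | _ | empty p _ = ⊥-elim (nothing≢just (trans (sym p) se))
  ... | _ | vacate p (a , c , sa) with just-injective (trans (sym p) se)
  ...   | refl = a , slide-fill i s a sa (e , c , p)
  slide-keeps-label i s e se | _ | keep _ p ¬d with just-injective (trans (sym p) se)
  ...   | refl = e , slide-keep i s e se ¬d

  slide-keeps-hole : ∀ i s e → s e ≡ nothing → ∃ λ e′ → slide i s e′ ≡ nothing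
  slide-keeps-hole i s e se with nothing-or-just (slide i s e)
  ... | inj₁ q = e , q
  ... | inj₂ (l , q) with slide-just⁻ i s e q
  ...   | inj₁ (_ , (b , c , sb) , _) = b , slide-vacate i s b sb (e , c , se)
  ...   | inj₂ (p , _) = ⊥-elim (nothing≢just (trans (sym se) p))

  record IsCoverPacked (m : ℕ) (L : Labeling n) : Set where
    field
      bounded    : ∀ e → 1 ≤ L e × L e ≤ m
      monotone   : ∀ a b → a ⋖ b → L a < L b
      surjective : ∀ k → 1 ≤ k → k ≤ m → ∃ λ e → L e ≡ k

  IsPackedLabeling⇒IsCoverPacked : ∀ {m L} → IsPackedLabeling n m L → IsCoverPacked m L
  IsPackedLabeling⇒IsCoverPacked (bounded , surjective , monotone) =
    record { bounded = bounded ; monotone = λ a b c → monotone a b [ c ] ; surjective = surjective }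

  -- Invariant of the state reached after the slides for the labels 2, …, t.
  record SlideInvariant (m t : ℕ) (s : State n) : Set where
    field
      bounded    : ∀ e {l} → s e ≡ just l → 2 ≤ l × l ≤ m
      monotone   : ∀ a b {l l′} → a ⋖ b → s a ≡ just l → s b ≡ just l′ → l < l′
      above-hole : ∀ a b → a ⋖ b → s a ≡ nothing → ∃ λ l → s b ≡ just l × t < l
      below-hole : ∀ a b {l} → a ⋖ b → s b ≡ nothing → s a ≡ just l → l ≤ t
      surjective : ∀ l → 2 ≤ l → l ≤ m → ∃ λ e → s e ≡ just l
      has-hole   : ∃ λ e → s e ≡ nothing

  erase1-cases : ∀ (L : Labeling n) e →
    (L e ≡ 1 × erase1 L e ≡ nothing) ⊎ (L e ≢ 1 × erase1 L e ≡ just (L e))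
  erase1-cases L e with L e
  ... | zero          = inj₂ ((λ ()) , refl)
  ... | suc zero      = inj₁ (refl , refl)
  ... | suc (suc _)   = inj₂ ((λ ()) , refl)

  module _ (L : Labeling n) (e : Elem n) where

    erase1-drop : L e ≡ 1 → erase1 L e ≡ nothing
    erase1-drop e≡1 with erase1-cases L e
    ... | inj₁ (_ , p)  = p
    ... | inj₂ (e≢1 , _) = ⊥-elim (e≢1 e≡1)

    erase1-keep : L e ≢ 1 → erase1 L e ≡ just (L e)
    erase1-keep e≢1 with erase1-cases L e
    ... | inj₁ (e≡1 , _) = ⊥-elim (e≢1 e≡1)
    ... | inj₂ (_ , p)  = p

    erase1-nothing⁻ : erase1 L e ≡ nothing → L e ≡ 1
    erase1-nothing⁻ q with erase1-cases L e
    ... | inj₁ (e≡1 , _) = e≡1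
    ... | inj₂ (_ , p)  = ⊥-elim (nothing≢just (trans (sym q) p))

    erase1-just⁻ : ∀ {l} → erase1 L e ≡ just l → L e ≡ l × L e ≢ 1
    erase1-just⁻ q with erase1-cases L e
    ... | inj₁ (_ , p)   = ⊥-elim (nothing≢just (trans (sym p) q))
    ... | inj₂ (e≢1 , p) = just-injective (trans (sym p) q) , e≢1

  erase1-invariant : ∀ {m L} → IsCoverPacked m L → 1 ≤ m → SlideInvariant m 1 (erase1 L)
  erase1-invariant {m} {L} P 1≤m = record
    { bounded = bounded′ ; monotone = monotone′ ; above-hole = above-hole′
    ; below-hole = below-hole′ ; surjective = surjective′ ; has-hole = has-hole′ }
    where
    open IsCoverPacked P
    s : State n
    s = erase1 L

    bounded′ : ∀ e {l} → s e ≡ just l → 2 ≤ l × l ≤ m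
    bounded′ e q with erase1-just⁻ L e q
    ... | refl , e≢1 = ≤∧≢⇒< (proj₁ (bounded e)) (e≢1 ∘ sym) , proj₂ (bounded e)

    monotone′ : ∀ a b {l l′} → a ⋖ b → s a ≡ just l → s b ≡ just l′ → l < l′
    monotone′ a b c qa qb with erase1-just⁻ L a qa | erase1-just⁻ L b qb
    ... | refl , _ | refl , _ = monotone a b c

    above-hole′ : ∀ a b → a ⋖ b → s a ≡ nothing → ∃ λ l → s b ≡ just l × 1 < l
    above-hole′ a b c qa =
      L b , erase1-keep L b (λ b≡1 → <-irrefl (trans a≡1 (sym b≡1)) a<b) , subst (_< L b) a≡1 a<b
      where
      a≡1 : L a ≡ 1
      a≡1 = erase1-nothing⁻ L a qa
      a<b : L a < L b
      a<b = monotone a b c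

    below-hole′ : ∀ a b {l} → a ⋖ b → s b ≡ nothing → s a ≡ just l → l ≤ 1
    below-hole′ a b c qb _ =
      ⊥-elim (<⇒≱ (subst (L a <_) (erase1-nothing⁻ L b qb) (monotone a b c)) (proj₁ (bounded a)))

    surjective′ : ∀ l → 2 ≤ l → l ≤ m → ∃ λ e → s e ≡ just l
    surjective′ l 2≤l l≤m with surjective l (≤-trans (s≤s z≤n) 2≤l) l≤m
    ... | e , refl = e , erase1-keep L e (λ e≡1 → <-irrefl (sym e≡1) 2≤l)

    has-hole′ : ∃ λ e → s e ≡ nothing
    has-hole′ with surjective 1 ≤-refl 1≤m
    ... | e , e≡1 = e , erase1-drop L e e≡1

  module SlidePreservation {m t s} (G : SlideInvariant m t s) (1≤t : 1 ≤ t) (t<m : t < m) where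
    open SlideInvariant G
    private
      s′ : State n
      s′ = slide (suc t) s

    bounded′ : ∀ e {l} → s′ e ≡ just l → 2 ≤ l × l ≤ m
    bounded′ e q with slide-just⁻ (suc t) s e q
    ... | inj₁ (_ , _ , refl) = s≤s 1≤t , t<m
    ... | inj₂ (p , _)        = bounded e p

    monotone′ : ∀ a b {l l′} → a ⋖ b → s′ a ≡ just l → s′ b ≡ just l′ → l < l′
    monotone′ a b c qa qb with slide-just⁻ (suc t) s a qa | slide-just⁻ (suc t) s b qb
    ... | inj₁ (ha , _ , _) | inj₁ (hb , _ , _) =
      let (_ , sb , _) = above-hole a b c ha in ⊥-elim (nothing≢just (trans (sym hb) sb))
    ... | inj₁ (ha , _ , refl) | inj₂ (jb , ¬d) =
      let (_ , sb , t<l) = above-hole a b c ha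
      in ≤∧≢⇒< (subst (t <_) (just-injective (trans (sym sb) jb)) t<l)
               (λ t+1≡l → ¬d (sym t+1≡l) (a , c , ha))
    ... | inj₂ (ja , _) | inj₁ (hb , _ , refl) = s≤s (below-hole a b c hb ja)
    ... | inj₂ (ja , _) | inj₂ (jb , _)        = monotone a b c ja jb

    above-hole′ : ∀ a b → a ⋖ b → s′ a ≡ nothing → ∃ λ l → s′ b ≡ just l × suc t < l
    above-hole′ a b c qa with slide-nothing⁻ (suc t) s a qa
    ... | inj₁ (ha , ¬u) with above-hole a b c ha
    ...   | l , sb , t<l =
      l , slide-keep (suc t) s b sb (λ l≡t+1 _ → l≢t+1 l≡t+1) , ≤∧≢⇒< t<l (l≢t+1 ∘ sym)
      where
      l≢t+1 : l ≢ suc t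
      l≢t+1 l≡t+1 = ¬u (b , c , trans sb (cong just l≡t+1))
    above-hole′ a b c qa | inj₂ (ja , _) with nothing-or-just (s b)
    ... | inj₁ hb = ⊥-elim (1+n≰n (below-hole a b c hb ja))
    ... | inj₂ (l , sb) = l , slide-keep (suc t) s b sb (λ l≡t+1 _ → <-irrefl (sym l≡t+1) t+1<l) , t+1<l
      where
      t+1<l : suc t < l
      t+1<l = monotone a b c ja sb

    below-hole′ : ∀ a b {l} → a ⋖ b → s′ b ≡ nothing → s′ a ≡ just l → l ≤ suc t
    below-hole′ a b c qb qa with slide-just⁻ (suc t) s a qa
    ... | inj₁ (_ , _ , refl) = ≤-refl
    ... | inj₂ (ja , _) with slide-nothing⁻ (suc t) s b qb
    ...   | inj₁ (hb , _) = m≤n⇒m≤1+n (below-hole a b c hb ja)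
    ...   | inj₂ (jb , _) = <⇒≤ (monotone a b c ja jb)

    preserved : SlideInvariant m (suc t) s′
    preserved = record
      { bounded    = bounded′
      ; monotone   = monotone′
      ; above-hole = above-hole′
      ; below-hole = below-hole′
      ; surjective = λ l 2≤l l≤m → let (e , se) = surjective l 2≤l l≤m in slide-keeps-label (suc t) s e se
      ; has-hole   = let (e , se) = has-hole in slide-keeps-hole (suc t) s e se
      }

  slidesFrom-preserves : ∀ {m} k t s → SlideInvariant m t s → 1 ≤ t → t + k ≤ m →
                         SlideInvariant m (t + k) (slidesFrom (suc t) k s)
  slidesFrom-preserves zero t s G _ _ = subst (λ u → SlideInvariant _ u s) (sym (+-identityʳ t)) G
  slidesFrom-preserves {m} (suc k) t s G 1≤t t+k+1≤m =
    subst (λ u → SlideInvariant m u (slidesFrom (suc t) (suc k) s)) (sym (+-suc t k))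
      (slidesFrom-preserves k (suc t) (slide (suc t) s)
        (SlidePreservation.preserved G 1≤t (<-≤-trans (s≤s (m≤m+n t k)) t+1+k≤m))
        (s≤s z≤n) t+1+k≤m)
    where
    t+1+k≤m : suc t + k ≤ m
    t+1+k≤m = ≤-trans (≤-reflexive (sym (+-suc t k))) t+k+1≤m

  finish-nothing : ∀ m (s : State n) e → s e ≡ nothing → finish m s e ≡ m
  finish-nothing m s e = cong (maybe (_∸ 1) m)

  finish-just : ∀ m (s : State n) e {l} → s e ≡ just l → finish m s e ≡ l ∸ 1
  finish-just m s e = cong (maybe (_∸ 1) m)

  finish-packed : ∀ {m} s → SlideInvariant m m s → 1 ≤ m → IsCoverPacked m (finish m s)
  finish-packed {m} s G 1≤m = record { bounded = bounded′ ; monotone = monotone′ ; surjective = surjective′ }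
    where
    open SlideInvariant G
    f : Labeling n
    f = finish m s

    bounded′ : ∀ e → 1 ≤ f e × f e ≤ m
    bounded′ e with nothing-or-just (s e)
    ... | inj₁ se rewrite finish-nothing m s e se = 1≤m , ≤-refl
    ... | inj₂ (l , se) rewrite finish-just m s e se =
      let (2≤l , l≤m) = bounded e se in ∸-monoˡ-≤ 1 2≤l , ≤-trans (m∸n≤m l 1) l≤m

    monotone′ : ∀ a b → a ⋖ b → f a < f b
    monotone′ a b c with nothing-or-just (s a) | nothing-or-just (s b)
    ... | inj₁ sa | _ =
      let (_ , sb , m<l) = above-hole a b c sa in ⊥-elim (<⇒≱ m<l (proj₂ (bounded b sb)))
    ... | inj₂ (l , sa) | inj₁ sb rewrite finish-just m s a sa | finish-nothing m s b sb =
      let (2≤l , l≤m) = bounded a sa in ≤-trans (∸-monoˡ-< {l} {1} {suc l} ≤-refl (<⇒≤ 2≤l)) l≤m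
    ... | inj₂ (l , sa) | inj₂ (_ , sb) rewrite finish-just m s a sa | finish-just m s b sb =
      ∸-monoˡ-< (monotone a b c sa sb) (<⇒≤ (proj₁ (bounded a sa)))

    surjective′ : ∀ k → 1 ≤ k → k ≤ m → ∃ λ e → f e ≡ k
    surjective′ k 1≤k k≤m with k ≟ m
    ... | yes refl = let (e , se) = has-hole in e , finish-nothing m s e se
    ... | no k≢m =
      let (e , se) = surjective (suc k) (s≤s 1≤k) (≤∧≢⇒< k≤m k≢m) in e , finish-just m s e se

  promotionK-packed : ∀ {m L} → 1 ≤ m → IsCoverPacked m L → IsCoverPacked m (promotionK m L)
  promotionK-packed {suc m} 1≤m P =
    finish-packed _ (slidesFrom-preserves m 1 _ (erase1-invariant P 1≤m) ≤-refl ≤-refl) 1≤m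

module _ {A : Set} (f : A → A) (φ : A → ℕ) (q : ℕ) (P : A → Set)
         (f-preserves : ∀ {a} → P a → P (f a))
         (phase-step : ∀ {a} → P a → φ (f a) + 1 ≡ φ a ⊎ φ (f a) + 1 ≡ φ a + q) where

  iter-preserves : ∀ {a} → P a → ∀ k → P (iter f k a)
  iter-preserves Pa zero    = Pa
  iter-preserves Pa (suc k) = f-preserves (iter-preserves Pa k)

  phase-iter : ∀ {a} → P a → ∀ k → ∃ λ c → φ (iter f k a) + k ≡ φ a + c * q
  phase-iter Pa zero = 0 , refl
  phase-iter {a} Pa (suc k) with phase-iter Pa k | phase-step (iter-preserves Pa k)
  ... | c , eq | inj₁ step = c , (begin
    φ (f M) + suc k  ≡⟨ +-assoc (φ (f M)) 1 k ⟨
    φ (f M) + 1 + k  ≡⟨ cong (_+ k) step ⟩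
    φ M + k          ≡⟨ eq ⟩
    φ a + c * q      ∎)
    where open ≡-Reasoning
          M : A
          M = iter f k a
  ... | c , eq | inj₂ step = suc c , (begin
    φ (f M) + suc k  ≡⟨ +-assoc (φ (f M)) 1 k ⟨
    φ (f M) + 1 + k  ≡⟨ cong (_+ k) step ⟩
    φ M + q + k      ≡⟨ xy∙z≈xz∙y (φ M) q k ⟩
    φ M + k + q      ≡⟨ cong (_+ q) eq ⟩
    φ a + c * q + q  ≡⟨ +-assoc (φ a) (c * q) q ⟩
    φ a + (c * q + q) ≡⟨ cong (φ a +_) (+-comm (c * q) q) ⟩
    φ a + suc c * q  ∎)
    where open ≡-Reasoning
          M : A
          M = iter f k a

  phase-period-divisible : ∀ {a} → P a → ∀ p → φ (iter f p a) ≡ φ a → q ∣ p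
  phase-period-divisible {a} Pa p returns =
    let (c , eq) = phase-iter Pa p
    in divides c (+-cancelˡ-≡ (φ a) p (c * q) (trans (cong (_+ p) (sym returns)) eq))

x₀-or-has-lower-cover : ∀ {n} (e : Elem (suc n)) → e ≡ x zero ⊎ ∃ λ a → a ⋖ e
x₀-or-has-lower-cover (x zero)    = inj₁ refl
x₀-or-has-lower-cover (x (suc j)) =
  inj₂ (x (inject₁ j) , ≡⇒≡ᵇ (suc (toℕ j)) (suc (toℕ (inject₁ j))) (cong suc (sym (toℕ-inject₁ j))))
x₀-or-has-lower-cover (y j)       = inj₂ (x j , ≡⇒≡ᵇ (toℕ j) (toℕ j) refl)

x₀-not-over-hole : ∀ {n} (s : State (suc n)) → ¬ OverHole s (x zero)
x₀-not-over-hole s (x _ , () , _)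
x₀-not-over-hole s (y _ , () , _)

y-not-under-label : ∀ {n} i (s : State n) j → ¬ UnderLabel i s (y j)
y-not-under-label i s j (_ , () , _)

over-hole-y₀ : ∀ {n} (s : State (suc n)) → OverHole s (y zero) → s (x zero) ≡ nothing
over-hole-y₀ s (x zero , _ , sx₀)  = sx₀
over-hole-y₀ s (x (suc _) , () , _)
over-hole-y₀ s (y _ , () , _)

slidesFrom-keeps-y₀ : ∀ {n} k i (s : State (suc n)) {a b} →
  s (x zero) ≡ just a → s (y zero) ≡ just b → slidesFrom i k s (y zero) ≡ just b
slidesFrom-keeps-y₀ zero    i s sx₀ sy₀ = sy₀
slidesFrom-keeps-y₀ (suc k) i s sx₀ sy₀ =
  slidesFrom-keeps-y₀ k (suc i) (slide i s)
    (slide-keep i s (x zero) sx₀ (λ _ → x₀-not-over-hole s))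
    (slide-keep i s (y zero) sy₀ (λ _ d → nothing≢just (trans (sym (over-hole-y₀ s d)) sx₀)))

slidesFrom-keeps-empty-y : ∀ {n} k i (s : State n) j → s (y j) ≡ nothing → slidesFrom i k s (y j) ≡ nothing
slidesFrom-keeps-empty-y zero    i s j sy = sy
slidesFrom-keeps-empty-y (suc k) i s j sy =
  slidesFrom-keeps-empty-y k (suc i) (slide i s) j (slide-stays-empty i s (y j) sy (y-not-under-label i s j))

module _ {n m : ℕ} {L : Labeling (suc n)} (P : IsCoverPacked m L) where
  open IsCoverPacked P

  label-one⇒x₀ : ∀ e → L e ≡ 1 → e ≡ x zero
  label-one⇒x₀ e e≡1 with x₀-or-has-lower-cover e
  ... | inj₁ e≡x₀    = e≡x₀
  ... | inj₂ (a , c) = ⊥-elim (<⇒≱ (subst (L a <_) e≡1 (monotone a e c)) (proj₁ (bounded a)))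

  x₀-label-one : 1 ≤ m → L (x zero) ≡ 1
  x₀-label-one 1≤m =
    let (e , e≡1) = surjective 1 ≤-refl 1≤m in subst (λ e → L e ≡ 1) (label-one⇒x₀ e e≡1) e≡1

  label-two-covers-x₀ : 1 ≤ m → ∀ e → L e ≡ 2 → x zero ⋖ e
  label-two-covers-x₀ 1≤m e e≡2 with x₀-or-has-lower-cover e
  ... | inj₁ refl    = ⊥-elim (1+n≢n (trans (sym e≡2) (x₀-label-one 1≤m)))
  ... | inj₂ (a , c) = subst (_⋖ e) (label-one⇒x₀ a a≡1) c
    where
    a≡1 : L a ≡ 1
    a≡1 = ≤-antisym (≤-pred (subst (L a <_) e≡2 (monotone a e c))) (proj₁ (bounded a))

module _ {n m : ℕ} {L : Labeling (suc n)} (P : IsCoverPacked (suc (suc m)) L) where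
  open IsCoverPacked P
  private
    s₀ s₁ : State (suc n)
    s₀ = erase1 L
    s₁ = slide 2 s₀
    x₀-hole : s₀ (x zero) ≡ nothing
    x₀-hole = erase1-drop L (x zero) (x₀-label-one P (s≤s z≤n))
    1<y₀ : 1 < L (y zero)
    1<y₀ = subst (_< L (y zero)) (x₀-label-one P (s≤s z≤n)) (monotone (x zero) (y zero) tt)
    y₀-kept : s₀ (y zero) ≡ just (L (y zero))
    y₀-kept = erase1-keep L (y zero) (λ y₀≡1 → <-irrefl (sym y₀≡1) 1<y₀)

  promotionK-y₀-two : L (y zero) ≡ 2 → promotionK (suc (suc m)) L (y zero) ≡ suc (suc m)
  promotionK-y₀-two y₀≡2 =
    finish-nothing _ (slidesFrom 3 m s₁) (y zero) (slidesFrom-keeps-empty-y m 3 s₁ zero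
      (slide-vacate 2 s₀ (y zero) (trans y₀-kept (cong just y₀≡2)) (x zero , tt , x₀-hole)))

  promotionK-y₀-other : L (y zero) ≢ 2 → promotionK (suc (suc m)) L (y zero) ≡ L (y zero) ∸ 1
  promotionK-y₀-other y₀≢2 =
    finish-just _ (slidesFrom 3 m s₁) (y zero) (slidesFrom-keeps-y₀ m 3 s₁ x₀-filled
      (slide-keep 2 s₀ (y zero) y₀-kept (λ y₀≡2 _ → y₀≢2 y₀≡2)))
    where
    x₀-filled : s₁ (x zero) ≡ just 2
    x₀-filled =
      let (e , e≡2) = surjective 2 (s≤s z≤n) (s≤s (s≤s z≤n))
          e≢1 : L e ≢ 1
          e≢1 e≡1 = 1+n≢n (trans (sym e≡2) e≡1)
      in slide-fill 2 s₀ (x zero) x₀-hole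
           (e , label-two-covers-x₀ P (s≤s z≤n) e e≡2 , trans (erase1-keep L e e≢1) (cong just e≡2))

  y₀-phase-step : promotionK (suc (suc m)) L (y zero) ∸ 2 + 1 ≡ L (y zero) ∸ 2
                ⊎ promotionK (suc (suc m)) L (y zero) ∸ 2 + 1 ≡ L (y zero) ∸ 2 + suc m
  y₀-phase-step with L (y zero) ≟ 2
  ... | yes y₀≡2 = inj₂ (begin
    promotionK (suc (suc m)) L (y zero) ∸ 2 + 1
      ≡⟨ cong (λ l → l ∸ 2 + 1) (promotionK-y₀-two y₀≡2) ⟩
    m + 1                                        ≡⟨ +-comm m 1 ⟩
    suc m                                        ≡⟨ cong (λ l → l ∸ 2 + suc m) y₀≡2 ⟨
    L (y zero) ∸ 2 + suc m                       ∎)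
    where open ≡-Reasoning
  ... | no y₀≢2 = inj₁ (begin
    promotionK (suc (suc m)) L (y zero) ∸ 2 + 1
      ≡⟨ cong (λ l → l ∸ 2 + 1) (promotionK-y₀-other y₀≢2) ⟩
    L (y zero) ∸ 1 ∸ 2 + 1                       ≡⟨ pred∸2+1 (≤∧≢⇒< 1<y₀ (y₀≢2 ∘ sym)) ⟩
    L (y zero) ∸ 2                               ∎)
    where open ≡-Reasoning
          pred∸2+1 : ∀ {l} → 2 < l → l ∸ 1 ∸ 2 + 1 ≡ l ∸ 2
          pred∸2+1 {suc (suc (suc l))} _ = +-comm l 1
          pred∸2+1 {1} (s≤s ())
          pred∸2+1 {2} (s≤s (s≤s ()))

promotionK-period-divisible : ∀ {n m} {L : Labeling (suc n)} → IsCoverPacked (suc (suc m)) L →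
  ∀ p → iter (promotionK (suc (suc m))) p L (y zero) ≡ L (y zero) → suc m ∣ p
promotionK-period-divisible {m = m} P p returns =
  phase-period-divisible (promotionK (suc (suc m))) (λ L → L (y zero) ∸ 2) (suc m) (IsCoverPacked (suc (suc m)))
    (promotionK-packed (s≤s z≤n)) y₀-phase-step P p (cong (_∸ 2) returns)

proposition4p1 : (n m : ℕ) → 1 ≤ n → n + 1 ≤ m → m ≤ 2 * n →
    (L : Labeling n) → IsPackedLabeling n m L →
    (p : ℕ) → IsOrbitSize n m L p → (m ∸ 1) ∣ p
proposition4p1 (suc n) (suc (suc m)) _ _ _ L packed p (_ , returns , _) =
  promotionK-period-divisible (IsPackedLabeling⇒IsCoverPacked packed) p (returns (y zero))
proposition4p1 (suc n) 1 _ (s≤s n+1≤0) _ _ _ _ _ with ≤-trans (m≤n+m 1 n) n+1≤0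
... | ()
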